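{- For every first-order unification context $\Delta$, the saturation process terminates: every sequence $\Delta=\Delta_1\to\Delta_2\to\cdots$ in which each $\Delta_{i+1}$ is obtained from $\Delta_i$ by applying a saturation rule whose conclusion is not already contained in $\Delta_i$ is finite, and it ends in a saturated context (one to which no rule adds anything new).
   Context: Fix constructors $c,d,e$ (with arities), unification metavariables tagged contractive ($H^{\mathrm{con}}$) or recursive ($H^{\mathrm{rec}}$), and recursion constants $\underline r,\underline s,\underline t$. Contractive terms $U ::= c\,N_1\cdots N_n\mid H^{\mathrm{con}}$; recursive terms $N ::= \underline r\mid H^{\mathrm{rec}}$. A unification context is a finite collection of equations $U_1\doteq U_2$, equations $N_1\doteq N_2$, recursive definitions $\underline r=_dU$, and possibly the symbol $\mathrm{contra}$. Saturation rules (if all premises are in the context, add the conclusion): SIMP-F: $c\,N_1\cdots N_n\doteq d\,N'_1\cdots N'_m$ with $c\neq d$ $\Rightarrow\mathrm{contra}$. SIMP: $c\,N_1\cdots N_n\doteq c\,N'_1\cdots N'_n\Rightarrow N_i\doteq N'_i$ for all $i$. R-EXP: $\underline r\doteq\underline s$, $\underline r=_dU_1$, $\underline s=_dU_2\Rightarrow U_1\doteq U_2$. U-SYM: $U\doteq U'\Rightarrow U'\doteq U$. U-TRANS: $U_1\doteq U_2$, $U_2\doteq U_3\Rightarrow U_1\doteq U_3$. N-SYM, N-TRANS: the same for recursive terms $N$. -}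

module Defs where

open import Data.Nat using (ℕ)
open import Data.Fin using (Fin)
open import Data.Vec using (Vec; lookup)
open import Data.List using (List; _∷_)
open import Data.List.Membership.Propositional using (_∈_; _∉_)
open import Data.Product using (Σ; _×_)
open import Relation.Binary.PropositionalEquality using (_≡_; _≢_)
open import Relation.Binary.Definitions using (DecidableEquality)

record Signature : Set₁ where
  field
    Con   : Set
    arity : Con → ℕ
    Meta  : Set
    RConst : Set
    _≟Con_ : DecidableEquality Con
    _≟Meta_ : DecidableEquality Meta
    _≟RConst_ : DecidableEquality RConst

module _ (S : Signature) where
  open Signature S

  mutual
    data RTerm : Set where
      const : RConst → RTerm
      hrec  : Meta → RTerm

    data CTerm : Set where
      app  : (c : Con) → Vec RTerm (arity c) → CTerm
      hcon : Meta → CTerm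

  data Fact : Set where
    ueq    : CTerm → CTerm → Fact
    neq    : RTerm → RTerm → Fact
    rdef   : RConst → CTerm → Fact
    contra : Fact

  -- a unification context: a finite collection of facts (a list, read as a set)
  Context : Set
  Context = List Fact

  data Rule (Δ : Context) : Fact → Set where
    simp-f : ∀ {c d Ns Ms} → c ≢ d → ueq (app c Ns) (app d Ms) ∈ Δ → Rule Δ contra
    simp   : ∀ {c Ns Ms} → ueq (app c Ns) (app c Ms) ∈ Δ →
             (i : Fin (arity c)) → Rule Δ (neq (lookup Ns i) (lookup Ms i))
    r-exp  : ∀ {r s U₁ U₂} → neq (const r) (const s) ∈ Δ → rdef r U₁ ∈ Δ →
             rdef s U₂ ∈ Δ → Rule Δ (ueq U₁ U₂)
    u-sym  : ∀ {U U′} → ueq U U′ ∈ Δ → Rule Δ (ueq U′ U)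
    u-trans : ∀ {U₁ U₂ U₃} → ueq U₁ U₂ ∈ Δ → ueq U₂ U₃ ∈ Δ → Rule Δ (ueq U₁ U₃)
    n-sym  : ∀ {N N′} → neq N N′ ∈ Δ → Rule Δ (neq N′ N)
    n-trans : ∀ {N₁ N₂ N₃} → neq N₁ N₂ ∈ Δ → neq N₂ N₃ ∈ Δ → Rule Δ (neq N₁ N₃)

  Step : Context → Context → Set
  Step Δ Δ′ = Σ Fact (λ φ → Rule Δ φ × φ ∉ Δ × Δ′ ≡ φ ∷ Δ)

  Saturated : Context → Set
  Saturated Δ = ∀ φ → Rule Δ φ → φ ∈ Δ

module Submission where

-- Saturation never invents terms: SIMP only descends to arguments of contractive
-- terms already present, R-EXP only fetches bodies of existing definitions, and
-- the remaining rules recombine the two sides of existing equations. So every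
-- derivable fact lies in a finite universe fixed by the initial context, and
-- the number of universe facts not yet derived strictly drops at each step.

open import Data.Empty using (⊥-elim)
open import Data.Fin using (Fin)
open import Data.List using (List; []; _∷_; _++_; concatMap; length; filter; cartesianProductWith)
open import Data.List.Membership.Propositional using (_∈_; _∉_)
open import Data.List.Membership.Propositional.Properties
  using (∈-++⁺ˡ; ∈-++⁺ʳ; ∈-concat⁺′; ∈-map⁺; ∈-cartesianProductWith⁺; ∈-filter⁺; ∈-filter⁻)
open import Data.List.Relation.Binary.Pointwise using (Pointwise-≡⇒≡)
open import Data.List.Relation.Binary.Sublist.Propositional using (⊆-refl) renaming (_⊆_ to Sublist)
open import Data.List.Relation.Binary.Sublist.Propositional.Properties using (filter⁺; length-mono-≤; to-≋)
open import Data.List.Relation.Unary.All as All using (All; _∷_)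
open import Data.List.Relation.Unary.Any using (here; there)
open import Data.Nat using (ℕ; _<_)
open import Data.Nat.Induction using (<-wellFounded)
open import Data.Nat.Properties using (≤∧≢⇒<)
open import Data.Product using (Σ; _×_; _,_; proj₁; proj₂; swap)
open import Data.Product.Properties using () renaming (≡-dec to Σ-≡-dec)
open import Data.Sum using (_⊎_; inj₁; inj₂)
open import Data.Sum.Properties using () renaming (≡-dec to ⊎-≡-dec)
open import Data.Unit using (⊤; tt)
open import Data.Unit.Properties using () renaming (_≟_ to _≟⊤_)
open import Data.Vec using (Vec; toList; lookup)
open import Data.Vec.Membership.Propositional.Properties using (∈-lookup; ∈-toList⁺)
open import Data.Vec.Properties using () renaming (≡-dec to Vec-≡-dec)
open import Function using (flip; _∘_)
open import Function.Bundles using (mk↣)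
open import Function.Definitions using (Injective)
open import Induction.WellFounded using (Acc; acc)
open import Level using (0ℓ)
open import Relation.Binary.Construct.Closure.ReflexiveTransitive using (Star)
open import Relation.Binary.Definitions using (DecidableEquality)
open import Relation.Binary.PropositionalEquality using (_≡_; refl; subst; sym)
open import Relation.Nullary using (¬_; yes; no)
open import Relation.Nullary.Decidable using (via-injection)
open import Relation.Unary using (Pred; Decidable)

open import Defs

∈-concatMap⁺′ : {A B : Set} {f : A → List B} {x : A} {xs : List A} {y : B} →
                y ∈ f x → x ∈ xs → y ∈ concatMap f xs
∈-concatMap⁺′ {f = f} y∈fx x∈xs = ∈-concat⁺′ y∈fx (∈-map⁺ f x∈xs)

module _ {A : Set} {P Q : Pred A 0ℓ} (P? : Decidable P) (Q? : Decidable Q) where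

  filter-length-< : (∀ {x} → Q x → P x) → ∀ {x xs} → x ∈ xs → P x → ¬ Q x →
                    length (filter Q? xs) < length (filter P? xs)
  filter-length-< Q⇒P {x} {xs} x∈xs Px ¬Qx =
    ≤∧≢⇒< (length-mono-≤ sub) (λ eq → ¬Qx (proj₂ (∈-filter⁻ Q? {xs = xs} (x∈Q eq))))
    where
    sub : Sublist (filter Q? xs) (filter P? xs)
    sub = filter⁺ Q? P? (λ { refl → Q⇒P }) (⊆-refl {x = xs})
    x∈Q : length (filter Q? xs) ≡ length (filter P? xs) → x ∈ filter Q? xs
    x∈Q eq = subst (x ∈_) (sym (Pointwise-≡⇒≡ (to-≋ eq sub))) (∈-filter⁺ P? x∈xs Px)

module _ {A : Set} (_≟_ : DecidableEquality A) where
  open import Data.List.Membership.DecPropositional _≟_ using (_∉?_)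

  missing : List A → List A → ℕ
  missing U Δ = length (filter (_∉? Δ) U)

  missing-∷-< : ∀ {U Δ x} → x ∈ U → x ∉ Δ → missing U (x ∷ Δ) < missing U Δ
  missing-∷-< {Δ = Δ} {x} x∈U x∉Δ =
    filter-length-< (_∉? Δ) (_∉? x ∷ Δ) (_∘ there) x∈U x∉Δ (λ x∉x∷Δ → x∉x∷Δ (here refl))

module _ (S : Signature) where
  open Signature S

  RTerm-view : RTerm S → RConst ⊎ Meta
  RTerm-view (const r) = inj₁ r
  RTerm-view (hrec H)  = inj₂ H

  RTerm-view-injective : Injective _≡_ _≡_ RTerm-view
  RTerm-view-injective {const _} {const _} refl = refl
  RTerm-view-injective {hrec _}  {hrec _}  refl = refl

  _≟R_ : DecidableEquality (RTerm S)
  _≟R_ = via-injection (mk↣ RTerm-view-injective) (⊎-≡-dec _≟RConst_ _≟Meta_)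

  CTerm-view : CTerm S → Σ Con (Vec (RTerm S) ∘ arity) ⊎ Meta
  CTerm-view (app c Ns) = inj₁ (c , Ns)
  CTerm-view (hcon H)   = inj₂ H

  CTerm-view-injective : Injective _≡_ _≡_ CTerm-view
  CTerm-view-injective {app _ _} {app _ _} refl = refl
  CTerm-view-injective {hcon _}  {hcon _}  refl = refl

  _≟C_ : DecidableEquality (CTerm S)
  _≟C_ = via-injection (mk↣ CTerm-view-injective)
           (⊎-≡-dec (Σ-≡-dec _≟Con_ (Vec-≡-dec _≟R_)) _≟Meta_)

  Fact-view : Fact S → (CTerm S × CTerm S) ⊎ (RTerm S × RTerm S) ⊎ (RConst × CTerm S) ⊎ ⊤
  Fact-view (ueq U₁ U₂) = inj₁ (U₁ , U₂)
  Fact-view (neq N₁ N₂) = inj₂ (inj₁ (N₁ , N₂))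
  Fact-view (rdef r U)  = inj₂ (inj₂ (inj₁ (r , U)))
  Fact-view contra      = inj₂ (inj₂ (inj₂ tt))

  Fact-view-injective : Injective _≡_ _≡_ Fact-view
  Fact-view-injective {ueq _ _}  {ueq _ _}  refl = refl
  Fact-view-injective {neq _ _}  {neq _ _}  refl = refl
  Fact-view-injective {rdef _ _} {rdef _ _} refl = refl
  Fact-view-injective {contra}   {contra}   refl = refl

  _≟F_ : DecidableEquality (Fact S)
  _≟F_ = via-injection (mk↣ Fact-view-injective)
           (⊎-≡-dec (Σ-≡-dec _≟C_ _≟C_)
             (⊎-≡-dec (Σ-≡-dec _≟R_ _≟R_)
               (⊎-≡-dec (Σ-≡-dec _≟RConst_ _≟C_) _≟⊤_)))

  open import Data.List.Membership.DecPropositional _≟F_ using (_∈?_)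

  conTermsOf : Fact S → List (CTerm S)
  conTermsOf (ueq U₁ U₂) = U₁ ∷ U₂ ∷ []
  conTermsOf (rdef _ U)  = U ∷ []
  conTermsOf _           = []

  recTermsOf : Fact S → List (RTerm S)
  recTermsOf (neq N₁ N₂) = N₁ ∷ N₂ ∷ []
  recTermsOf _           = []

  arguments : CTerm S → List (RTerm S)
  arguments (app _ Ns) = toList Ns
  arguments (hcon _)   = []

  module _ (Δ₀ : Context S) where

    conTerms : List (CTerm S)
    conTerms = concatMap conTermsOf Δ₀

    recTerms : List (RTerm S)
    recTerms = concatMap recTermsOf Δ₀ ++ concatMap arguments conTerms

    Bounded : Fact S → Set
    Bounded (ueq U₁ U₂) = U₁ ∈ conTerms × U₂ ∈ conTerms
    Bounded (neq N₁ N₂) = N₁ ∈ recTerms × N₂ ∈ recTerms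
    Bounded (rdef r U)  = rdef r U ∈ Δ₀
    Bounded contra      = ⊤

    universe : List (Fact S)
    universe = contra ∷ Δ₀ ++ cartesianProductWith ueq conTerms conTerms
                            ++ cartesianProductWith neq recTerms recTerms

    bounded⇒∈universe : ∀ {φ} → Bounded φ → φ ∈ universe
    bounded⇒∈universe {ueq _ _}  (p , q) = there (∈-++⁺ʳ Δ₀ (∈-++⁺ˡ (∈-cartesianProductWith⁺ ueq p q)))
    bounded⇒∈universe {neq _ _}  (p , q) = there (∈-++⁺ʳ Δ₀ (∈-++⁺ʳ _ (∈-cartesianProductWith⁺ neq p q)))
    bounded⇒∈universe {rdef _ _} p       = there (∈-++⁺ˡ p)
    bounded⇒∈universe {contra}   _       = here refl

    initial-bounded : ∀ {φ} → φ ∈ Δ₀ → Bounded φ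
    initial-bounded {ueq _ _}  p = ∈-concatMap⁺′ (here refl) p , ∈-concatMap⁺′ (there (here refl)) p
    initial-bounded {neq _ _}  p = ∈-++⁺ˡ (∈-concatMap⁺′ (here refl) p) ,
                                   ∈-++⁺ˡ (∈-concatMap⁺′ (there (here refl)) p)
    initial-bounded {rdef _ _} p = p
    initial-bounded {contra}   _ = tt

    argument-bounded : ∀ {c Ms} → app c Ms ∈ conTerms → (i : Fin (arity c)) → lookup Ms i ∈ recTerms
    argument-bounded {Ms = Ms} p i =
      ∈-++⁺ʳ (concatMap recTermsOf Δ₀) (∈-concatMap⁺′ (∈-toList⁺ (∈-lookup i Ms)) p)

    rule-bounded : ∀ {Δ φ} → All Bounded Δ → Rule S Δ φ → Bounded φ
    rule-bounded bs (simp-f _ _)  = tt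
    rule-bounded bs (simp p i)    = argument-bounded (proj₁ (All.lookup bs p)) i ,
                                    argument-bounded (proj₂ (All.lookup bs p)) i
    rule-bounded bs (r-exp _ p q) = ∈-concatMap⁺′ (here refl) (All.lookup bs p) ,
                                    ∈-concatMap⁺′ (here refl) (All.lookup bs q)
    rule-bounded bs (u-sym p)     = swap (All.lookup bs p)
    rule-bounded bs (u-trans p q) = proj₁ (All.lookup bs p) , proj₂ (All.lookup bs q)
    rule-bounded bs (n-sym p)     = swap (All.lookup bs p)
    rule-bounded bs (n-trans p q) = proj₁ (All.lookup bs p) , proj₂ (All.lookup bs q)

    bounded-step-accessible : ∀ Δ → All Bounded Δ → Acc _<_ (missing _≟F_ universe Δ) →
                              Acc (flip (Step S)) Δ
    bounded-step-accessible Δ bs (acc rec) = acc λ { (φ , rule , φ∉Δ , refl) →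
      let bφ = rule-bounded bs rule in
      bounded-step-accessible (φ ∷ Δ) (bφ ∷ bs)
        (rec (missing-∷-< _≟F_ (bounded⇒∈universe bφ) φ∉Δ)) }

    saturation-terminates : Acc (flip (Step S)) Δ₀
    saturation-terminates = bounded-step-accessible Δ₀ (All.tabulate initial-bounded) (<-wellFounded _)

  stuck⇒saturated : ∀ Δ → (∀ Δ′ → ¬ Step S Δ Δ′) → Saturated S Δ
  stuck⇒saturated Δ stuck φ rule with φ ∈? Δ
  ... | yes φ∈Δ = φ∈Δ
  ... | no  φ∉Δ = ⊥-elim (stuck (φ ∷ Δ) (φ , rule , φ∉Δ , refl))

theorem2p6 : (S : Signature) → (Δ : Context S) →
    Acc (flip (Step S)) Δ
    × (∀ Δ′ → Star (Step S) Δ Δ′ → (∀ Δ″ → ¬ Step S Δ′ Δ″) → Saturated S Δ′)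
theorem2p6 S Δ = saturation-terminates S Δ , λ Δ′ _ → stuck⇒saturated S Δ′
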